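{- If $X\subseteq\mathbb{N}$ is $\omega^2\cdot3$-sparse and $\min X\geq7$, then $X$ is $(x\mapsto x^{R_x(2x+2)})$-sparse.
   Context: A set $X\subseteq\mathbb{N}$ is $\alpha$-sparse (for an ordinal $\alpha$) if for all $x<y$ in $X$ the interval $(x,y]\cap\mathbb{N}$ is $\alpha$-large; for a function $g:\mathbb{N}\to\mathbb{N}$, $X$ is $g$-sparse if $y>g(x)$ for all $x<y$ in $X$. $R_k(d)$ is the least $R$ such that every $f:[\{0,\dots,R-1\}]^2\to k$ admits a homogeneous set of size $d$. Fundamental sequences: $\{0\}(x)=0$; for $\alpha\neq0$ write $\alpha=\delta+\omega^\gamma$ in Cantor normal form with $\omega^\gamma$ the last term; $\{\alpha\}(x)=\delta$ if $\gamma=0$, $\delta+\omega^{\gamma'}\cdot x$ if $\gamma=\gamma'+1$, $\delta+\omega^{\{\gamma\}(x)}$ if $\gamma$ is a limit. For finite $X=\{x_0<\dots<x_s\}$, $\{\alpha\}(X)=\{\cdots\{\{\alpha\}(x_0)\}(x_1)\cdots\}(x_s)$ and $X$ is $\alpha$-large iff $\{\alpha\}(X)=0$. -}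

module Defs where

open import Data.Nat using (ℕ; zero; suc; _+_; _*_; _∸_; _^_; _<_; _≤_)
open import Data.Fin using (Fin; toℕ)
open import Data.List using (List; []; _∷_; map; upTo)
open import Data.Product using (Σ; ∃; _×_)
open import Relation.Binary.PropositionalEquality using (_≡_)

-- Ordinals (below ε₀) as formal Cantor normal forms written in "snoc" form:
-- 𝟎 is 0, and  δ ⊕ω^ γ  is  δ + ω^γ  (ω^γ being the LAST Cantor-normal-form term).
data Ord : Set where
  𝟎     : Ord
  _⊕ω^_ : Ord → Ord → Ord

infixl 6 _⊕ω^_

addMul : Ord → Ord → ℕ → Ord
addMul δ γ zero    = δ
addMul δ γ (suc x) = addMul δ γ x ⊕ω^ γ

fs : Ord → ℕ → Ord
fs 𝟎 x = 𝟎
fs (δ ⊕ω^ 𝟎) x = δ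
fs (δ ⊕ω^ (γ' ⊕ω^ 𝟎)) x = addMul δ γ' x              -- γ = γ' + 1
fs (δ ⊕ω^ (γ₀ ⊕ω^ (η ⊕ω^ ζ))) x = δ ⊕ω^ fs (γ₀ ⊕ω^ (η ⊕ω^ ζ)) x   -- γ limit

fsList : Ord → List ℕ → Ord
fsList α []       = α
fsList α (x ∷ xs) = fsList (fs α x) xs

Large : Ord → List ℕ → Set
Large α X = fsList α X ≡ 𝟎

interval : ℕ → ℕ → List ℕ
interval x y = map (λ i → x + suc i) (upTo (y ∸ x))

OrdSparse : Ord → (ℕ → Set) → Set
OrdSparse α X = ∀ x y → X x → X y → x < y → Large α (interval x y)

FunSparse : (ℕ → ℕ) → (ℕ → Set) → Set
FunSparse g X = ∀ x y → X x → X y → x < y → g x < y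

ω²·3 : Ord
ω²·3 = 𝟎 ⊕ω^ two ⊕ω^ two ⊕ω^ two
  where two = 𝟎 ⊕ω^ 𝟎 ⊕ω^ 𝟎

-- R → (d)²_k : every k-colouring of pairs from {0,…,R-1} has a homogeneous set of size d.
-- (colourings are given on all ordered pairs; only values at i < j matter)
Arrows : ℕ → ℕ → ℕ → Set
Arrows k d R =
  (f : Fin R → Fin R → Fin k) →
  Σ (Fin d → Fin R) λ h →
    (∀ (i j : Fin d) → toℕ i < toℕ j → toℕ (h i) < toℕ (h j)) ×
    ∃ λ (c : Fin k) → ∀ (i j : Fin d) → toℕ i < toℕ j → f (h i) (h j) ≡ c

IsRamseyNumber : ℕ → ℕ → ℕ → Set
IsRamseyNumber k d R = Arrows k d R × (∀ R' → Arrows k d R' → R ≤ R')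

-- A pre-homogeneous sequence for f : [R]² → k (every vertex sends one colour to all
-- later ones) of length kd + 1 is found greedily inside any R > ramseyBound k (kd + 1), and
-- pigeonhole on the attached colours leaves d vertices of one colour; so R_k(d) ≤ (k+1)^(kd+1).
-- On the ordinal side, a block of consecutive integers starting at a that is ω²-large ends beyond
-- 2^a (a+1), so an ω²·3-large interval (x, y] yields a₁, a₂ with 2^(x+1) (x+2) ≤ a₁, 2^a₁ ≤ a₂ and
-- 2^a₂ < y.  With j = 2x² + 2x + 1 and x ≥ 4 one gets x·R_x(2x+2) ≤ x (x+1)^j ≤ 2^(x(j+1)) ≤ 2^a₁ ≤ a₂,
-- whence x^R ≤ 2^(xR) ≤ 2^a₂ < y.
{-# OPTIONS --safe #-}
module Submission where

open import Defs
open import Data.Nat using (ℕ; zero; suc; _+_; _*_; _∸_; _^_; _<_; _≤_; z≤n; s≤s; _<?_; NonZero; >-nonZero; >-nonZero⁻¹)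
open import Data.Nat.Properties
open import Data.Nat.Tactic.RingSolver using (solve-∀)
open import Data.Fin as Fin using (Fin; toℕ; inject≤)
open import Data.Fin.Properties using (toℕ-inject≤)
open import Data.List using (List; []; _∷_; length; filter; lookup; allFin; map; applyUpTo)
open import Data.List.Properties using (length-tabulate)
open import Data.List.Membership.Propositional using (_∈_)
open import Data.List.Membership.Propositional.Properties using (∈-filter⁻; ∈-allFin; ∈-lookup)
import Data.List.Relation.Binary.Sublist.Propositional.Properties as Sublist
open import Data.List.Relation.Unary.Any using (here; there)
open import Data.List.Relation.Unary.All as All using (All; []; _∷_)
import Data.List.Relation.Unary.All.Properties as Allₚ
open import Data.List.Relation.Unary.AllPairs using (AllPairs; []; _∷_)
import Data.List.Relation.Unary.AllPairs.Properties as AllPairs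
open import Data.Product using (Σ; ∃; ∃₂; _×_; _,_; proj₁; proj₂; map₂)
open import Data.Bool using (true; false)
open import Data.Empty using (⊥-elim)
open import Function using (_∘_; _∘′_; id)
open import Level using (0ℓ)
open import Relation.Nullary using (yes; no; does)
open import Relation.Unary using (Pred; Decidable)
open import Relation.Unary.Properties using (∁?)
open import Relation.Binary.Definitions using (DecidableEquality)
open import Relation.Binary.PropositionalEquality using (_≡_; refl; sym; trans; cong; cong₂; subst; subst₂)

length-filter-+-∁ : ∀ {A : Set} {P : Pred A 0ℓ} (P? : Decidable P) xs →
                    length (filter P? xs) + length (filter (∁? P?) xs) ≡ length xs
length-filter-+-∁ P? [] = refl
length-filter-+-∁ P? (x ∷ xs) with does (P? x)
... | true  = cong suc (length-filter-+-∁ P? xs)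
... | false = trans (+-suc _ _) (cong suc (length-filter-+-∁ P? xs))

AllPairs-lookup : ∀ {A : Set} {R : A → A → Set} {xs} → AllPairs R xs →
                  ∀ {i j : Fin (length xs)} → i Fin.< j → R (lookup xs i) (lookup xs j)
AllPairs-lookup (Rx ∷ _)   {Fin.zero}  {Fin.suc j} _         = All.lookup Rx (∈-lookup j)
AllPairs-lookup (_ ∷ Rxs) {Fin.suc i} {Fin.suc j} (s≤s i<j) = AllPairs-lookup Rxs i<j

length-filter-filter-≤ : ∀ {A : Set} {P Q : Pred A 0ℓ} (P? : Decidable P) (Q? : Decidable Q) xs →
                         length (filter P? (filter Q? xs)) ≤ length (filter P? xs)
length-filter-filter-≤ P? Q? xs =
  Sublist.length-mono-≤ (Sublist.filter⁺ P? P? (λ { refl Px → Px }) (Sublist.filter-⊆ Q? xs))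

module _ {A C : Set} (_≟_ : DecidableEquality C) (colour : A → C) where

  colouredBy? : (c : C) → Decidable (λ x → colour x ≡ c)
  colouredBy? c x = colour x ≟ c

  pigeonhole : ∀ (cs : List C) {m} xs → All (λ x → colour x ∈ cs) xs → length cs * m < length xs →
               ∃ λ c → m < length (filter (colouredBy? c) xs)
  pigeonhole [] (x ∷ xs) (() ∷ _) _
  pigeonhole (c ∷ cs) {m} xs xs∈ big with m <? length (filter (colouredBy? c) xs)
  ... | yes m<c = c , m<c
  ... | no m≮c  = map₂ (λ m<c′ → <-≤-trans m<c′ (length-filter-filter-≤ _ _ xs))
                       (pigeonhole cs rest rest∈ rest-big)
    where
    rest = filter (∁? (colouredBy? c)) xs
    rest∈ : All (λ x → colour x ∈ cs) rest
    rest∈ = All.map (λ { (here c≡ , c≢) → ⊥-elim (c≢ c≡) ; (there x∈ , _) → x∈ })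
                    (All.zip (Allₚ.filter⁺ _ xs∈ , Allₚ.all-filter (∁? (colouredBy? c)) xs))
    rest-big : length cs * m < length rest
    rest-big = +-cancelˡ-< m _ _ (begin-strict
      m + length cs * m                                 <⟨ big ⟩
      length xs                                         ≡⟨ length-filter-+-∁ (colouredBy? c) xs ⟨
      length (filter (colouredBy? c) xs) + length rest  ≤⟨ +-monoˡ-≤ (length rest) (≮⇒≥ m≮c) ⟩
      m + length rest                                   ∎)
      where open ≤-Reasoning

pigeonhole-Fin : ∀ {A : Set} {k m} (colour : A → Fin k) xs → k * m < length xs →
                 ∃ λ c → m < length (filter (colouredBy? Fin._≟_ colour c) xs)
pigeonhole-Fin {k = k} {m} colour xs k*m<xs =
  pigeonhole Fin._≟_ colour (allFin k) xs (All.tabulate (λ {x} _ → ∈-allFin (colour x)))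
    (subst (λ l → l * m < length xs) (sym (length-tabulate {n = k} id)) k*m<xs)

ramseyBound : ℕ → ℕ → ℕ
ramseyBound k zero    = 0
ramseyBound k (suc j) = suc (k * ramseyBound k j)

module _ {k R : ℕ} (f : Fin R → Fin R → Fin k) where

  _⇝_ : Fin R × Fin k → Fin R × Fin k → Set
  (v , c) ⇝ (w , _) = v Fin.< w × f v w ≡ c

  edgeColour? : ∀ v c → Decidable (λ w → f v w ≡ c)
  edgeColour? v = colouredBy? Fin._≟_ (f v)

  preHomogeneous : ∀ j (S : List (Fin R)) → AllPairs Fin._<_ S → ramseyBound k j < length S →
                   ∃ λ P → j ≤ length P × AllPairs _⇝_ P × All (λ p → proj₁ p ∈ S) P
  preHomogeneous zero    S        _           _         = [] , z≤n , [] , []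
  preHomogeneous (suc j) (v ∷ S) (v<S ∷ S↗) (s≤s big)
    with c , big-c ← pigeonhole-Fin (f v) S big
    with P , j≤P , P⇝ , P⊆ ← preHomogeneous j (filter (edgeColour? v c) S) (AllPairs.filter⁺ _ S↗) big-c
    = (v , c) ∷ P , s≤s j≤P , All.map (λ {p} → v⇝ {p} ∘ ∈-filter⁻ (edgeColour? v c)) P⊆ ∷ P⇝
    , here refl ∷ All.map (there ∘ proj₁ ∘ ∈-filter⁻ (edgeColour? v c)) P⊆
    where
    v⇝ : ∀ {p} → proj₁ p ∈ S × f v (proj₁ p) ≡ c → (v , c) ⇝ p
    v⇝ (w∈S , fvw≡c) = All.lookup v<S w∈S , fvw≡c

  monochromaticSubset : ∀ {d} c (Q : List (Fin R × Fin k)) → AllPairs _⇝_ Q → All (λ p → proj₂ p ≡ c) Q →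
                        d ≤ length Q →
                        Σ (Fin d → Fin R) λ h → (∀ i j → toℕ i < toℕ j → toℕ (h i) < toℕ (h j))
                                              × (∀ i j → toℕ i < toℕ j → f (h i) (h j) ≡ c)
  monochromaticSubset {d} c Q Q⇝ Q-c d≤Q =
    proj₁ ∘ lookup Q ∘ ι , (λ i j → proj₁ ∘ ⇝-at i j)
    , λ i j i<j → trans (proj₂ (⇝-at i j i<j)) (All.lookup Q-c (∈-lookup (ι i)))
    where
    ι : Fin d → Fin (length Q)
    ι i = inject≤ i d≤Q
    ⇝-at : ∀ i j → i Fin.< j → lookup Q (ι i) ⇝ lookup Q (ι j)
    ⇝-at i j = AllPairs-lookup Q⇝ ∘ subst₂ _<_ (sym (toℕ-inject≤ i d≤Q)) (sym (toℕ-inject≤ j d≤Q))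

  homogeneousSubset : ∀ d (P : List (Fin R × Fin k)) → AllPairs _⇝_ P → k * d < length P →
                      Σ (Fin d → Fin R) λ h → (∀ i j → toℕ i < toℕ j → toℕ (h i) < toℕ (h j))
                                            × ∃ λ c → ∀ i j → toℕ i < toℕ j → f (h i) (h j) ≡ c
  homogeneousSubset d P P⇝ kd<P with c , d<Q ← pigeonhole-Fin proj₂ P kd<P
    with h , h↗ , h-c ← monochromaticSubset c _ (AllPairs.filter⁺ _ P⇝) (Allₚ.all-filter _ P) (<⇒≤ d<Q)
    = h , h↗ , c , h-c

arrows-ramseyBound : ∀ k d → Arrows k d (suc (ramseyBound k (suc (k * d))))
arrows-ramseyBound k d f
  with P , kd<P , P⇝ , _ ← preHomogeneous f (suc (k * d)) (allFin _) (AllPairs.tabulate⁺-< id)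
                                          (subst (ramseyBound k (suc (k * d)) <_) (sym (length-tabulate id)) ≤-refl)
  = homogeneousSubset f d P P⇝ kd<P

ramseyBound-< : ∀ k .{{_ : NonZero k}} j → ramseyBound k j < suc k ^ j
ramseyBound-< k zero    = s≤s z≤n
ramseyBound-< k (suc j) = begin-strict
  suc (k * N)              <⟨ +-mono-≤ (m^n>0 (suc k) j) (+-monoˡ-≤ (k * N) (>-nonZero⁻¹ k)) ⟩
  suc k ^ j + (k + k * N)  ≡⟨ cong (suc k ^ j +_) (*-suc k N) ⟨
  suc k ^ j + k * suc N    ≤⟨ +-monoʳ-≤ (suc k ^ j) (*-monoʳ-≤ k (ramseyBound-< k j)) ⟩
  suc k ^ suc j            ∎
  where
  open ≤-Reasoning
  N = ramseyBound k j

IsRamseyNumber⇒≤ : ∀ {k d R} .{{_ : NonZero k}} → IsRamseyNumber k d R → R ≤ suc k ^ suc (k * d)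
IsRamseyNumber⇒≤ {k} {d} (_ , least) = ≤-trans (least _ (arrows-ramseyBound k d)) (ramseyBound-< k _)

fin : ℕ → Ord
fin k = addMul 𝟎 𝟎 k

ω^_ : Ord → Ord
ω^ α = 𝟎 ⊕ω^ α

ω·_ : ℕ → Ord
ω· m = addMul 𝟎 (fin 1) m

ω² : Ord
ω² = ω^ fin 2

infixl 5 _++ᴼ_

-- Juxtaposition of Cantor normal forms; it is the ordinal sum δ + γ only when no term of δ is absorbed.
_++ᴼ_ : Ord → Ord → Ord
δ ++ᴼ 𝟎        = δ
δ ++ᴼ (γ ⊕ω^ e) = (δ ++ᴼ γ) ⊕ω^ e

addMul-++ᴼ : ∀ δ γ e x → addMul (δ ++ᴼ γ) e x ≡ δ ++ᴼ addMul γ e x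
addMul-++ᴼ δ γ e zero    = refl
addMul-++ᴼ δ γ e (suc x) = cong (_⊕ω^ e) (addMul-++ᴼ δ γ e x)

fs-++ᴼ : ∀ δ γ e x → fs (δ ++ᴼ (γ ⊕ω^ e)) x ≡ δ ++ᴼ fs (γ ⊕ω^ e) x
fs-++ᴼ δ γ 𝟎                   x = refl
fs-++ᴼ δ γ (e ⊕ω^ 𝟎)           x = addMul-++ᴼ δ γ e x
fs-++ᴼ δ γ (e₀ ⊕ω^ (η ⊕ω^ ζ)) x = refl

consecutive : ℕ → ℕ → List ℕ
consecutive a zero    = []
consecutive a (suc n) = a ∷ consecutive (suc a) n

LargeBlock : Ord → ℕ → ℕ → Set
LargeBlock α a n = Large α (consecutive a n)

LargeBlock-++ᴼ⁻ : ∀ δ γ {a} n → LargeBlock (δ ++ᴼ γ) a n →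
                  ∃₂ λ n₁ n₂ → n ≡ n₁ + n₂ × LargeBlock γ a n₁ × LargeBlock δ (a + n₁) n₂
LargeBlock-++ᴼ⁻ δ 𝟎        {a} n       large = 0 , n , refl , refl , subst (λ b → LargeBlock δ b n) (sym (+-identityʳ a)) large
LargeBlock-++ᴼ⁻ δ (γ ⊕ω^ e) {a} (suc n) large
  with n₁ , n₂ , refl , γ-large , δ-large
         ← LargeBlock-++ᴼ⁻ δ (fs (γ ⊕ω^ e) a) n (subst (λ α → LargeBlock α (suc a) n) (fs-++ᴼ δ γ e a) large)
  = suc n₁ , n₂ , refl , γ-large , subst (λ b → LargeBlock δ b n₂) (sym (+-suc a n₁)) δ-large

LargeBlock-fin : ∀ k {a} n → LargeBlock (fin k) a n → k ≤ n
LargeBlock-fin zero    n       _     = z≤n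
LargeBlock-fin (suc k) (suc n) large = s≤s (LargeBlock-fin k n large)

LargeBlock-ω : ∀ a n → LargeBlock (ω^ fin 1) a n → suc a ≤ n
LargeBlock-ω a (suc n) large = s≤s (LargeBlock-fin a n large)

LargeBlock-ω·m : ∀ m a n → LargeBlock (ω· m) a n → 2 ^ m * a ≤ a + n
LargeBlock-ω·m zero    a n _ = ≤-trans (≤-reflexive (+-identityʳ a)) (m≤m+n a n)
LargeBlock-ω·m (suc m) a n large
  with n₁ , n₂ , refl , ω-large , ω·m-large ← LargeBlock-++ᴼ⁻ (ω· m) (ω^ fin 1) n large
  = begin
    2 ^ suc m * a         ≡⟨ *-assoc 2 (2 ^ m) a ⟩
    2 * (2 ^ m * a)       ≡⟨ cong (2 ^ m * a +_) (+-identityʳ (2 ^ m * a)) ⟩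
    2 ^ m * a + 2 ^ m * a ≡⟨ *-distribˡ-+ (2 ^ m) a a ⟨
    2 ^ m * (a + a)       ≤⟨ *-monoʳ-≤ (2 ^ m) (+-monoʳ-≤ a (≤-trans (n≤1+n a) (LargeBlock-ω a n₁ ω-large))) ⟩
    2 ^ m * (a + n₁)      ≤⟨ LargeBlock-ω·m m (a + n₁) n₂ ω·m-large ⟩
    a + n₁ + n₂           ≡⟨ +-assoc a n₁ n₂ ⟩
    a + (n₁ + n₂)         ∎
  where open ≤-Reasoning

LargeBlock-ω² : ∀ a n → LargeBlock ω² a n → 2 ^ a * suc a ≤ a + n
LargeBlock-ω² a (suc n) large = ≤-trans (LargeBlock-ω·m a (suc a) n large) (≤-reflexive (sym (+-suc a n)))

LargeBlock-ω²·3 : ∀ a n → LargeBlock ω²·3 a n →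
                  ∃₂ λ b₁ b₂ → 2 ^ a * suc a ≤ b₁ × 2 ^ b₁ * suc b₁ ≤ b₂ × 2 ^ b₂ * suc b₂ ≤ a + n
LargeBlock-ω²·3 a n large
  with n₁ , n′ , refl , large₁ , large′ ← LargeBlock-++ᴼ⁻ (ω² ++ᴼ ω²) ω² n large
  with n₂ , n₃ , refl , large₂ , large₃ ← LargeBlock-++ᴼ⁻ ω² ω² n′ large′
  = a + n₁ , a + n₁ + n₂ , LargeBlock-ω² a n₁ large₁ , LargeBlock-ω² (a + n₁) n₂ large₂
  , ≤-trans (LargeBlock-ω² (a + n₁ + n₂) n₃ large₃)
            (≤-reflexive (trans (+-assoc (a + n₁) n₂ n₃) (+-assoc a n₁ (n₂ + n₃))))

map-applyUpTo-consecutive : ∀ (f g : ℕ → ℕ) a n → (∀ i → g (f i) ≡ a + i) → map g (applyUpTo f n) ≡ consecutive a n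
map-applyUpTo-consecutive f g a zero    _   = refl
map-applyUpTo-consecutive f g a (suc n) g∘f = cong₂ _∷_ (trans (g∘f 0) (+-identityʳ a))
  (map-applyUpTo-consecutive (f ∘′ suc) g (suc a) n (λ i → trans (g∘f (suc i)) (+-suc a i)))

interval≡consecutive : ∀ x y → interval x y ≡ consecutive (suc x) (y ∸ x)
interval≡consecutive x y = map-applyUpTo-consecutive id (λ i → x + suc i) (suc x) (y ∸ x) (λ i → +-suc x i)

ω²·3-large-interval : ∀ {x y} → x < y → Large ω²·3 (interval x y) →
                      ∃₂ λ a₁ a₂ → 2 ^ suc x * suc (suc x) ≤ a₁ × 2 ^ a₁ * suc a₁ ≤ a₂ × 2 ^ a₂ * suc a₂ ≤ suc y
ω²·3-large-interval {x} {y} x<y large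
  with a₁ , a₂ , x→a₁ , a₁→a₂ , a₂→y
         ← LargeBlock-ω²·3 (suc x) (y ∸ x) (subst (Large ω²·3) (interval≡consecutive x y) large)
  = a₁ , a₂ , x→a₁ , a₁→a₂ , ≤-trans a₂→y (≤-reflexive (cong suc (m+[n∸m]≡n (<⇒≤ x<y))))

n<2^n : ∀ n → n < 2 ^ n
n<2^n zero    = s≤s z≤n
n<2^n (suc n) = +-mono-≤ (m^n>0 2 n) (≤-trans (n<2^n n) (m≤m+n (2 ^ n) 0))

n*n≤2^n : ∀ {n} → 4 ≤ n → n * n ≤ 2 ^ n
n*n≤2^n (s≤s (s≤s (s≤s (s≤s {n = t} z≤n)))) = [4+t]²≤2^[4+t] t
  where
  [5+t]²+[7+6t+t²]≡2[4+t]² : ∀ t → (5 + t) * (5 + t) + (7 + 6 * t + t * t) ≡ 2 * ((4 + t) * (4 + t))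
  [5+t]²+[7+6t+t²]≡2[4+t]² = solve-∀
  [4+t]²≤2^[4+t] : ∀ t → (4 + t) * (4 + t) ≤ 2 ^ (4 + t)
  [4+t]²≤2^[4+t] zero    = ≤-refl
  [4+t]²≤2^[4+t] (suc t) = begin
    (5 + t) * (5 + t)                        ≤⟨ m≤m+n _ _ ⟩
    (5 + t) * (5 + t) + (7 + 6 * t + t * t)  ≡⟨ [5+t]²+[7+6t+t²]≡2[4+t]² t ⟩
    2 * ((4 + t) * (4 + t))                  ≤⟨ *-monoʳ-≤ 2 ([4+t]²≤2^[4+t] t) ⟩
    2 ^ (5 + t)                              ∎
    where open ≤-Reasoning

x*[2+x*[2x+2]]≤2^[1+x]*[2+x] : ∀ {x} → 4 ≤ x → x * suc (suc (x * (2 * x + 2))) ≤ 2 ^ suc x * suc (suc x)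
x*[2+x*[2x+2]]≤2^[1+x]*[2+x] {x} 4≤x = begin
  x * suc (suc (x * (2 * x + 2)))  ≤⟨ polynomial x ⟩
  2 * (x * x) * (2 + x)            ≤⟨ *-monoˡ-≤ (2 + x) (*-monoʳ-≤ 2 (n*n≤2^n 4≤x)) ⟩
  2 ^ suc x * suc (suc x)          ∎
  where
  open ≤-Reasoning
  identity : ∀ t → let x = suc t in x * suc (suc (x * (2 * x + 2))) + 2 * x * t ≡ 2 * (x * x) * (2 + x)
  identity = solve-∀
  polynomial : ∀ x → x * suc (suc (x * (2 * x + 2))) ≤ 2 * (x * x) * (2 + x)
  polynomial zero    = z≤n
  polynomial (suc t) = ≤-trans (m≤m+n _ _) (≤-reflexive (identity t))

x*R≤2^[x*[1+j]] : ∀ x j {R} → R ≤ suc x ^ j → x * R ≤ 2 ^ (x * suc j)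
x*R≤2^[x*[1+j]] x j {R} R≤ = begin
  x * R              ≤⟨ *-mono-≤ (<⇒≤ (n<2^n x)) (≤-trans R≤ (^-monoˡ-≤ j (n<2^n x))) ⟩
  2 ^ x * (2 ^ x) ^ j ≡⟨ cong (2 ^ x *_) (^-*-assoc 2 x j) ⟩
  2 ^ x * 2 ^ (x * j) ≡⟨ ^-distribˡ-+-* 2 x (x * j) ⟨
  2 ^ (x + x * j)     ≡⟨ cong (2 ^_) (*-suc x j) ⟨
  2 ^ (x * suc j)     ∎
  where open ≤-Reasoning

2^a<y : ∀ {a y} → 0 < a → 2 ^ a * suc a ≤ suc y → 2 ^ a < y
2^a<y {a} {y} 0<a bound = ≤-pred (begin
  2 + 2 ^ a        ≤⟨ +-monoˡ-≤ (2 ^ a) (^-monoʳ-≤ 2 0<a) ⟩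
  2 ^ a + 2 ^ a    ≡⟨ cong (2 ^ a +_) (+-identityʳ (2 ^ a)) ⟨
  2 * 2 ^ a        ≡⟨ *-comm 2 (2 ^ a) ⟩
  2 ^ a * 2        ≤⟨ *-monoʳ-≤ (2 ^ a) (s≤s 0<a) ⟩
  2 ^ a * suc a    ≤⟨ bound ⟩
  suc y            ∎)
  where open ≤-Reasoning

mainTheorem19 : (X : ℕ → Set) → OrdSparse ω²·3 X → (∀ x → X x → 7 ≤ x) →
    ∀ x y → X x → X y → x < y →
      ∀ R → IsRamseyNumber x (2 * x + 2) R → x ^ R < y
mainTheorem19 X sparse ≥7 x y Xx Xy x<y R isRamsey
  with a₁ , a₂ , x→a₁ , a₁→a₂ , a₂→y ← ω²·3-large-interval x<y (sparse x y Xx Xy x<y)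
  = begin-strict
    x ^ R        ≤⟨ ^-monoˡ-≤ R (<⇒≤ (n<2^n x)) ⟩
    (2 ^ x) ^ R  ≡⟨ ^-*-assoc 2 x R ⟩
    2 ^ (x * R)  ≤⟨ ^-monoʳ-≤ 2 xR≤a₂ ⟩
    2 ^ a₂       <⟨ 2^a<y (≤-trans (m^n>0 2 a₁) 2^a₁≤a₂) a₂→y ⟩
    y            ∎
  where
  open ≤-Reasoning
  4≤x : 4 ≤ x
  4≤x = ≤-trans (m≤m+n 4 3) (≥7 x Xx)
  instance
    x≢0 : NonZero x
    x≢0 = >-nonZero (≤-trans (s≤s z≤n) 4≤x)
  2^a₁≤a₂ : 2 ^ a₁ ≤ a₂
  2^a₁≤a₂ = ≤-trans (m≤m*n (2 ^ a₁) (suc a₁)) a₁→a₂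
  xR≤a₂ : x * R ≤ a₂
  xR≤a₂ = begin
    x * R                                  ≤⟨ x*R≤2^[x*[1+j]] x _ (IsRamseyNumber⇒≤ isRamsey) ⟩
    2 ^ (x * suc (suc (x * (2 * x + 2))))  ≤⟨ ^-monoʳ-≤ 2 (≤-trans (x*[2+x*[2x+2]]≤2^[1+x]*[2+x] 4≤x) x→a₁) ⟩
    2 ^ a₁                                 ≤⟨ 2^a₁≤a₂ ⟩
    a₂                                     ∎
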